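{- Let $k \geq 2$, and let $A = \{a_0,a_1,\ldots,a_k\}$ be a finite set of integers such that $0 = a_0 < a_1 < \cdots < a_k$ and $\gcd(A) = 1$. For every positive integer $t$, let \[ h_t = (k-1)(t a_k - 1)a_k + 1. \] Then for every positive integer $t$ there are nonnegative integers $c_t$ and $d_t$ and finite sets $C_t$ and $D_t$ with \[ C_t \subseteq [0, c_t - 2] \quad\text{and}\quad D_t \subseteq [0, d_t - 2] \] such that \[ (hA)^{(t)} = C_t \cup [c_t, h a_k - d_t] \cup (h a_k - D_t) \] for all integers $h \geq h_t$.
   Context: For integers $u,v$, $[u,v] = \{n \in \mathbf{Z} : u \leq n \leq v\}$ (possibly empty). For a set $D$ of integers and an integer $w$, $w - D = \{w - d : d \in D\}$. For a set $A$ of integers and a positive integer $h$, the representation function $r_{A,h}(n)$ is the number of $h$-tuples $(a_{j_1},\ldots,a_{j_h}) \in A^h$ with $a_{j_1} \leq \cdots \leq a_{j_h}$ and $n = \sum_{i=1}^h a_{j_i}$; equivalently, the number of families $(u_a)_{a \in A}$ of nonnegative integers with $\sum_{a\in A} u_a a = n$ and $\sum_{a \in A} u_a = h$. For a positive integer $t$, $(hA)^{(t)} = \{n \in \mathbf{Z} : r_{A,h}(n) \geq t\}$, the set of integers having at least $t$ representations as a sum of $h$ (not necessarily distinct) elements of $A$. -}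

module Defs where

open import Data.Nat as ℕ using (ℕ; zero; suc; _∸_)
open import Data.Integer as ℤ using (ℤ; +_)
open import Data.List using (List; []; _∷_; [_]; map; concatMap; upTo; filter; length; foldr)
open import Data.Fin using (Fin)
open import Data.Integer.GCD using (gcd)
open import Data.Vec.Functional using (toList)
open import Relation.Binary.PropositionalEquality using (_≡_)
open import Relation.Nullary using (Dec)

families : ℕ → ℕ → List (List ℕ)
families zero    zero    = [ [] ]
families zero    (suc h) = []
families (suc m) h       =
  concatMap (λ u → map (u ∷_) (families m (h ∸ u))) (upTo (suc h))

weight : List ℕ → List ℤ → ℤ
weight (u ∷ us) (x ∷ xs) = (+ u) ℤ.* x ℤ.+ weight us xs
weight _        _        = + 0

-- The set A = {a_0, ..., a_k} as a list (the a_i are distinct)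
elems : {k : ℕ} → (Fin (suc k) → ℤ) → List ℤ
elems a = toList a

-- r_{A,h}(n): number of families (u_a)_{a ∈ A} of nonnegative integers
-- with Σ u_a = h and Σ u_a a = n.
rep : {k : ℕ} → (Fin (suc k) → ℤ) → ℕ → ℤ → ℕ
rep {k} a h n =
  length (filter (λ u → weight u (elems a) ℤ.≟ n) (families (suc k) h))

-- the set (hA)^(t) = { n ∈ ℤ : r_{A,h}(n) ≥ t }, as a predicate
hAt : {k : ℕ} → (Fin (suc k) → ℤ) → ℕ → ℕ → ℤ → Set
hAt a h t n = t ℕ.≤ rep a h n

-- gcd of the set A = {a_0,...,a_k} (iterated gcd, gcd of the empty family = 0)
gcdSet : {k : ℕ} → (Fin (suc k) → ℤ) → ℤ
gcdSet a = foldr gcd (+ 0) (elems a)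

-- Work over ℕ with the elements 0 < y₁ < ⋯ < y_{k−1} < A = a_k. Since 0 ∈ A, its multiplicity lets a
-- representation of m change its number of summands freely as long as there are at least m of them, so for
-- h ≥ m the count r_{A,h}(m) is a stable value; C collects the m below the threshold c whose stable count
-- reaches t. The reflection a ↦ A − a maps A to a set of the same kind and n ↦ hA − n between the two
-- representation counts, which gives D at the top end. Every m ≥ c in the lower half of [0, hA] has t
-- representations: below a bound N₀ by the choice of c, and beyond it by construction, since gcd(A) = 1
-- gives small eᵢ with Σ eᵢ yᵢ ≡ m (mod A), copies of A fill up the rest, and trading A copies of y₁ for y₁
-- copies of A yields t distinct representations; h ≥ h_t leaves room for all of this. Reflection covers the
-- upper half.

module Submission where

module Naturals where

  open import Defs
  open import Data.Nat as ℕ using (ℕ; zero; suc; _+_; _*_; _∸_; _≤_; _<_; z≤n; s≤s; NonZero; _≤?_; _<?_)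
  open import Data.Nat.Properties
  open import Data.Nat.ListAction using (sum)
  open import Data.Nat.DivMod using (_%_; _/_; m≡m%n+[m/n]*n; m%n<n; %-distribˡ-+; %-distribˡ-*; m%n%n≡m%n; n%n≡0; [m+kn]%n≡m%n; /-monoˡ-≤)
  open import Data.Nat.Divisibility using (_∣_; ∣-refl; ∣-trans; ∣m+n∣m⇒∣n)
  open import Data.Nat.GCD using (gcd; gcd[m,n]∣m; gcd[m,n]∣n; gcd-GCD; module Bézout)
  open import Data.List using (List; []; _∷_; [_]; map; upTo; filter; length; take; _++_; reverse; foldr; applyUpTo)
  open import Data.List.Properties
    using (∷-injectiveˡ; ∷-injectiveʳ; length-++; length-take; length-map; length-reverse; unfold-reverse; reverse-injective; length-applyUpTo;
           reverse-++; reverse-map; reverse-involutive; map-++)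
  open import Data.Nat.ListAction.Properties using (sum-↭; sum-++)
  open import Data.List.Relation.Binary.Permutation.Propositional using (↭-sym)
  open import Data.List.Relation.Binary.Permutation.Propositional.Properties using (↭-reverse; All-resp-↭)
  open import Data.Nat.Tactic.RingSolver using (solve-∀)
  open import Data.List.Relation.Unary.All as All using (All; []; _∷_)
  import Data.List.Relation.Unary.All.Properties as All
  open import Data.List.Relation.Unary.Any as Any using (here; there)
  open import Data.List.Relation.Unary.AllPairs as AllPairs using ([]; _∷_)
  import Data.List.Relation.Unary.AllPairs.Properties as AllPairs
  open import Data.List.Relation.Unary.Unique.Propositional using (Unique)
  import Data.List.Relation.Unary.Unique.Propositional.Properties as Unique
  open import Data.List.Relation.Binary.Disjoint.Propositional using (Disjoint)
  open import Data.List.Membership.Propositional using (_∈_; find)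
  open import Data.List.Membership.Propositional.Properties
  open import Data.Product using (Σ; _×_; _,_; proj₁; proj₂)
  open import Data.Sum using (_⊎_; inj₁; inj₂)
  open import Data.Empty using (⊥-elim)
  open import Relation.Nullary using (¬_; Dec; yes; no)
  open import Relation.Unary using (Decidable)
  open import Relation.Binary.PropositionalEquality hiding ([_])
  open import Function using (_∘_)
  open import Function.Bundles using (_⇔_; mk⇔)

  -- Representations as lists of multiplicities

  infixl 7 _·_

  _·_ : List ℕ → List ℕ → ℕ
  (u ∷ us) · (x ∷ xs) = u * x + us · xs
  _        · _        = 0

  IsRep : List ℕ → ℕ → ℕ → List ℕ → Set
  IsRep xs h n u = length u ≡ length xs × sum u ≡ h × u · xs ≡ n

  Reps : List ℕ → ℕ → ℕ → ℕ → Set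
  Reps xs h n t = Σ (List (List ℕ)) λ us → Unique us × length us ≡ t × All (IsRep xs h n) us

  count : List ℕ → ℕ → ℕ → ℕ
  count xs h n = length (filter (λ u → u · xs ≟ n) (families (length xs) h))

  bracket : List ℕ → ℕ → List ℕ
  bracket ys A = 0 ∷ ys ++ [ A ]

  families-sound : ∀ m h {u} → u ∈ families m h → length u ≡ m × sum u ≡ h
  families-sound zero    zero    (here refl) = refl , refl
  families-sound (suc m) h       u∈ with find (∈-concatMap⁻ _ {xs = upTo (suc h)} u∈)
  ... | x , x∈ , u∈′ with ∈-map⁻ (x ∷_) u∈′
  ...   | v , v∈ , refl with families-sound m (h ∸ x) v∈
  ...     | refl , sum≡ = refl , trans (cong (x +_) sum≡) (m+[n∸m]≡n (≤-pred (∈-upTo⁻ x∈)))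

  families-complete : ∀ u → u ∈ families (length u) (sum u)
  families-complete []      = here refl
  families-complete (x ∷ u) =
    ∈-concatMap⁺ (λ y → map (y ∷_) (families (length u) (x + sum u ∸ y)))
      (Any.map (λ { refl → ∈-map⁺ (x ∷_) (subst (λ s → u ∈ families (length u) s)
                                                (sym (m+n∸m≡n x (sum u))) (families-complete u)) })
               (∈-upTo⁺ (s≤s (m≤m+n x (sum u)))))

  families-unique : ∀ m h → Unique (families m h)
  families-unique zero    zero    = [] ∷ []
  families-unique zero    (suc h) = []
  families-unique (suc m) h =
    Unique.concat⁺ (All.map⁺ (All.tabulate λ {x} _ → Unique.map⁺ ∷-injectiveʳ (families-unique m (h ∸ x))))
                   (AllPairs.map⁺ (AllPairs.map disjoint (Unique.upTo⁺ (suc h))))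
    where
    disjoint : ∀ {x y} → x ≢ y → Disjoint (map (x ∷_) (families m (h ∸ x))) (map (y ∷_) (families m (h ∸ y)))
    disjoint x≢y (u∈ , u∈′) with ∈-map⁻ _ u∈ | ∈-map⁻ _ u∈′
    ... | _ , _ , refl | _ , _ , eq = x≢y (∷-injectiveˡ eq)

  Unique-⊆⇒length≤ : ∀ {A : Set} (xs ys : List A) → Unique xs → All (_∈ ys) xs → length xs ≤ length ys
  Unique-⊆⇒length≤ []       ys _              _            = z≤n
  Unique-⊆⇒length≤ (x ∷ xs) ys (x∉xs ∷ uniq) (x∈ys ∷ xs⊆ys) with ∈-∃++ x∈ys
  ... | ys₁ , ys₂ , refl = begin
    suc (length xs)           ≤⟨ s≤s (Unique-⊆⇒length≤ xs (ys₁ ++ ys₂) uniq (All.zipWith drop-x (x∉xs , xs⊆ys))) ⟩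
    suc (length (ys₁ ++ ys₂)) ≡⟨ cong suc (length-++ ys₁) ⟩
    suc (length ys₁ + length ys₂) ≡⟨ sym (+-suc (length ys₁) (length ys₂)) ⟩
    length ys₁ + length (x ∷ ys₂) ≡⟨ sym (length-++ ys₁) ⟩
    length (ys₁ ++ x ∷ ys₂)   ∎
    where
    open ≤-Reasoning
    drop-x : ∀ {y} → x ≢ y × y ∈ ys₁ ++ x ∷ ys₂ → y ∈ ys₁ ++ ys₂
    drop-x (x≢y , y∈) with ∈-++⁻ ys₁ y∈
    ... | inj₁ y∈₁           = ∈-++⁺ˡ y∈₁
    ... | inj₂ (here refl)   = ⊥-elim (x≢y refl)
    ... | inj₂ (there y∈₂)   = ∈-++⁺ʳ ys₁ y∈₂

  Reps⇒≤count : ∀ xs h n t → Reps xs h n t → t ≤ count xs h n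
  Reps⇒≤count xs h n t (us , uniq , refl , reps) =
    Unique-⊆⇒length≤ us _ uniq (All.map member reps)
    where
    member : ∀ {u} → IsRep xs h n u → u ∈ filter (λ u → u · xs ≟ n) (families (length xs) h)
    member {u} (l , s , w) =
      ∈-filter⁺ (λ u → u · xs ≟ n) (subst₂ (λ m h → u ∈ families m h) l s (families-complete u)) w

  ≤count⇒Reps : ∀ xs h n t → t ≤ count xs h n → Reps xs h n t
  ≤count⇒Reps xs h n t t≤ =
    take t sols , Unique.take⁺ t (Unique.filter⁺ _ (families-unique (length xs) h)) ,
    trans (length-take t sols) (m≤n⇒m⊓n≡m t≤) ,
    All.take⁺ t (All.tabulate isRep)
    where
    sols : List (List ℕ)
    sols = filter (λ u → u · xs ≟ n) (families (length xs) h)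
    isRep : ∀ {u} → u ∈ sols → IsRep xs h n u
    isRep u∈ with ∈-filter⁻ (λ u → u · xs ≟ n) u∈
    ... | u∈fam , w with families-sound (length xs) h u∈fam
    ...   | l , s = l , s , w

  ·-≤ : ∀ M u xs → All (_≤ M) xs → u · xs ≤ sum u * M
  ·-≤ M []      xs       _          = z≤n
  ·-≤ M (c ∷ u) []       _          = z≤n
  ·-≤ M (c ∷ u) (x ∷ xs) (x≤M ∷ ps) =
    ≤-trans (+-mono-≤ (*-monoʳ-≤ c x≤M) (·-≤ M u xs ps)) (≤-reflexive (sym (*-distribʳ-+ M c (sum u))))

  sum-≤ : ∀ M u → All (_≤ M) u → sum u ≤ length u * M
  sum-≤ M []      _          = z≤n
  sum-≤ M (c ∷ u) (c≤M ∷ ps) = +-mono-≤ c≤M (sum-≤ M u ps)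

  ·-scale : ∀ c f xs → map (c *_) f · xs ≡ c * (f · xs)
  ·-scale c []      _        = sym (*-zeroʳ c)
  ·-scale c (_ ∷ _) []       = sym (*-zeroʳ c)
  ·-scale c (d ∷ f) (x ∷ xs) = begin
    c * d * x + map (c *_) f · xs  ≡⟨ cong (c * d * x +_) (·-scale c f xs) ⟩
    c * d * x + c * (f · xs)       ≡⟨ cong (_+ c * (f · xs)) (*-assoc c d x) ⟩
    c * (d * x) + c * (f · xs)     ≡⟨ sym (*-distribˡ-+ c (d * x) (f · xs)) ⟩
    c * (d * x + f · xs)           ∎
    where open ≡-Reasoning

  sum≤· : ∀ u zs → length u ≡ length zs → All (1 ≤_) zs → sum u ≤ u · zs
  sum≤· []      []       _  _          = z≤n
  sum≤· (c ∷ u) (z ∷ zs) eq (1≤z ∷ ps) =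
    +-mono-≤ (subst (_≤ c * z) (*-identityʳ c) (*-monoʳ-≤ c 1≤z)) (sum≤· u zs (suc-injective eq) ps)

  ·-snoc : ∀ u xs c x → length u ≡ length xs → (u ++ [ c ]) · (xs ++ [ x ]) ≡ u · xs + c * x
  ·-snoc []      []       c x _  = +-identityʳ (c * x)
  ·-snoc (d ∷ u) (y ∷ xs) c x eq =
    trans (cong (d * y +_) (·-snoc u xs c x (suc-injective eq))) (sym (+-assoc (d * y) (u · xs) (c * x)))

  ·-reverse : ∀ u xs → length u ≡ length xs → reverse u · reverse xs ≡ u · xs
  ·-reverse []      []       _  = refl
  ·-reverse (c ∷ u) (x ∷ xs) eq = begin
    reverse (c ∷ u) · reverse (x ∷ xs)      ≡⟨ cong₂ _·_ (unfold-reverse c u) (unfold-reverse x xs) ⟩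
    (reverse u ++ [ c ]) · (reverse xs ++ [ x ]) ≡⟨ ·-snoc (reverse u) (reverse xs) c x reversed-lengths ⟩
    reverse u · reverse xs + c * x          ≡⟨ cong (_+ c * x) (·-reverse u xs (suc-injective eq)) ⟩
    u · xs + c * x                          ≡⟨ +-comm (u · xs) (c * x) ⟩
    (c ∷ u) · (x ∷ xs)                      ∎
    where
    open ≡-Reasoning
    reversed-lengths : length (reverse u) ≡ length (reverse xs)
    reversed-lengths = trans (length-reverse u) (trans (suc-injective eq) (sym (length-reverse xs)))

  ·-complement : ∀ A u xs → length u ≡ length xs → All (_≤ A) xs → u · map (A ∸_) xs + u · xs ≡ sum u * A
  ·-complement A []      []       _  _          = refl
  ·-complement A (c ∷ u) (x ∷ xs) eq (x≤A ∷ ps) = begin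
    (c * (A ∸ x) + u · map (A ∸_) xs) + (c * x + u · xs) ≡⟨ interchange (c * (A ∸ x)) _ (c * x) _ ⟩
    (c * (A ∸ x) + c * x) + (u · map (A ∸_) xs + u · xs)
      ≡⟨ cong₂ _+_ (sym (*-distribˡ-+ c (A ∸ x) x)) (·-complement A u xs (suc-injective eq) ps) ⟩
    c * (A ∸ x + x) + sum u * A                          ≡⟨ cong (λ y → c * y + sum u * A) (m∸n+n≡m x≤A) ⟩
    c * A + sum u * A                                    ≡⟨ sym (*-distribʳ-+ A c (sum u)) ⟩
    (c + sum u) * A                                      ∎
    where
    open ≡-Reasoning
    interchange : ∀ p q r s → (p + q) + (r + s) ≡ (p + r) + (q + s)
    interchange = solve-∀

  Unique-map-injectiveOn : ∀ {P : List ℕ → Set} (f : List ℕ → List ℕ) →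
    (∀ {u v} → P u → P v → f u ≡ f v → u ≡ v) → ∀ {us} → All P us → Unique us → Unique (map f us)
  Unique-map-injectiveOn f inj []         []            = []
  Unique-map-injectiveOn f inj (pu ∷ pus) (u∉us ∷ uniq) =
    All.map⁺ (All.zipWith (λ (pv , u≢v) → u≢v ∘ inj pu pv) (pus , u∉us))
    ∷ Unique-map-injectiveOn f inj pus uniq

  -- The multiplicity of 0 absorbs any change of h, as long as h′ ≥ n: a representation of n has at most n
  -- nonzero summands, all of them ≥ 1.
  Reps-resize : ∀ zs {h h′ n t} → All (1 ≤_) zs → n ≤ h′ → Reps (0 ∷ zs) h n t → Reps (0 ∷ zs) h′ n t
  Reps-resize zs {h} {h′} {n} ones n≤h′ (us , uniq , len , reps) =
    map resize us , Unique-map-injectiveOn resize resize-injective reps uniq ,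
    trans (length-map resize us) len , All.map⁺ (All.map (λ {u} → resize-IsRep {u}) reps)
    where
    resize : List ℕ → List ℕ
    resize []      = []
    resize (_ ∷ v) = (h′ ∸ sum v) ∷ v
    resize-injective : ∀ {u v} → IsRep (0 ∷ zs) h n u → IsRep (0 ∷ zs) h n v → resize u ≡ resize v → u ≡ v
    resize-injective {c ∷ u} {c′ ∷ .u} (_ , s , _) (_ , s′ , _) refl =
      cong (_∷ u) (+-cancelʳ-≡ (sum u) c c′ (trans s (sym s′)))
    resize-IsRep : ∀ {u} → IsRep (0 ∷ zs) h n u → IsRep (0 ∷ zs) h′ n (resize u)
    resize-IsRep {c ∷ v} (len , _ , w) =
      len , m∸n+n≡m (≤-trans sum≤n n≤h′) , trans (cong (_+ v · zs) (*-zeroʳ (h′ ∸ sum v))) w′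
      where
      w′ : v · zs ≡ n
      w′ = trans (cong (_+ v · zs) (sym (*-zeroʳ c))) w
      sum≤n : sum v ≤ n
      sum≤n = subst (sum v ≤_) w′ (sum≤· v zs (suc-injective len) ones)

  -- Reflection

  reflect : ℕ → List ℕ → List ℕ
  reflect A xs = reverse (map (A ∸_) xs)

  Reps-reflect : ∀ A xs {h n t} → All (_≤ A) xs → Reps xs h n t → Reps (reflect A xs) h (h * A ∸ n) t
  Reps-reflect A xs {h} {n} xs≤A (us , uniq , len , reps) =
    map reverse us , Unique.map⁺ reverse-injective uniq ,
    trans (length-map reverse us) len , All.map⁺ (All.map (λ {u} → reflect-IsRep {u}) reps)
    where
    reflect-IsRep : ∀ {u} → IsRep xs h n u → IsRep (reflect A xs) h (h * A ∸ n) (reverse u)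
    reflect-IsRep {u} (l , s , w) =
      trans (length-reverse u) (trans l (sym (trans (length-reverse (map (A ∸_) xs)) (length-map _ xs)))) ,
      trans (sum-↭ (↭-reverse u)) s ,
      (begin
        reverse u · reflect A xs                   ≡⟨ ·-reverse u (map (A ∸_) xs) (trans l (sym (length-map _ xs))) ⟩
        u · map (A ∸_) xs                          ≡⟨ sym (m+n∸n≡m _ (u · xs)) ⟩
        u · map (A ∸_) xs + u · xs ∸ u · xs        ≡⟨ cong₂ _∸_ (·-complement A u xs l xs≤A) w ⟩
        sum u * A ∸ n                              ≡⟨ cong (λ s → s * A ∸ n) s ⟩
        h * A ∸ n                                  ∎)
      where open ≡-Reasoning

  reflect-bracket : ∀ A ys → reflect A (bracket ys A) ≡ bracket (reflect A ys) A
  reflect-bracket A ys = begin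
    reverse (A ∸ 0 ∷ map (A ∸_) (ys ++ [ A ]))          ≡⟨ cong (λ zs → reverse (A ∷ zs)) (map-++ (A ∸_) ys [ A ]) ⟩
    reverse (A ∷ map (A ∸_) ys ++ [ A ∸ A ])            ≡⟨ unfold-reverse A (map (A ∸_) ys ++ [ A ∸ A ]) ⟩
    reverse (map (A ∸_) ys ++ [ A ∸ A ]) ++ [ A ]       ≡⟨ cong (_++ [ A ]) (reverse-++ (map (A ∸_) ys) [ A ∸ A ]) ⟩
    A ∸ A ∷ reflect A ys ++ [ A ]                       ≡⟨ cong (λ z → z ∷ reflect A ys ++ [ A ]) (n∸n≡0 A) ⟩
    bracket (reflect A ys) A                            ∎
    where open ≡-Reasoning

  reflect-involutive : ∀ A ys → All (_≤ A) ys → reflect A (reflect A ys) ≡ ys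
  reflect-involutive A ys ys≤A = begin
    reverse (map (A ∸_) (reverse (map (A ∸_) ys)))  ≡⟨ cong reverse (reverse-map (A ∸_) (map (A ∸_) ys)) ⟩
    reverse (reverse (map (A ∸_) (map (A ∸_) ys)))  ≡⟨ reverse-involutive _ ⟩
    map (A ∸_) (map (A ∸_) ys)                      ≡⟨ complement-twice ys ys≤A ⟩
    ys                                              ∎
    where
    open ≡-Reasoning
    complement-twice : ∀ zs → All (_≤ A) zs → map (A ∸_) (map (A ∸_) zs) ≡ zs
    complement-twice []       []          = refl
    complement-twice (z ∷ zs) (z≤A ∷ ps)  = cong₂ _∷_ (m∸[m∸n]≡n z≤A) (complement-twice zs ps)

  length-reflect : ∀ A ys → length (reflect A ys) ≡ length ys
  length-reflect A ys = trans (length-reverse (map (A ∸_) ys)) (length-map (A ∸_) ys)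

  All-reflect : ∀ {P : ℕ → Set} A ys → All (λ y → P (A ∸ y)) ys → All P (reflect A ys)
  All-reflect A ys ps = All-resp-↭ (↭-sym (↭-reverse _)) (All.map⁺ ps)

  JointlyCoprime : ℕ → List ℕ → Set
  JointlyCoprime A ys = ∀ {d} → d ∣ A → All (d ∣_) ys → d ≡ 1

  JointlyCoprime-reflect : ∀ A ys → All (_≤ A) ys → JointlyCoprime A ys → JointlyCoprime A (reflect A ys)
  JointlyCoprime-reflect A ys ys≤A coprime {d} d∣A d∣ys′ =
    coprime d∣A (All.zipWith (λ (y≤A , d∣A∸y) → ∣m+n∣m⇒∣n (subst (d ∣_) (sym (m∸n+n≡m y≤A)) d∣A) d∣A∸y)
                             (ys≤A , All.map⁻ (All-resp-↭ (↭-reverse _) d∣ys′)))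

  -- Many representations of large n

  -- The j-th representation (j ≤ T) trades j·A copies of y₁ for j·y₁ copies of A.
  Reps-trade : ∀ A .{{_ : NonZero A}} y₁ ys′ e₁ es q T {h n} → length es ≡ length ys′ → T * y₁ ≤ q →
    sum (e₁ ∷ es) + T * A + q ≤ h → n ≡ (e₁ ∷ es) · (y₁ ∷ ys′) + q * A →
    Reps (bracket (y₁ ∷ ys′) A) h n (suc T)
  Reps-trade A y₁ ys′ e₁ es q T {h} {n} len Ty₁≤q fits n≡ =
    applyUpTo traded (suc T) ,
    Unique.applyUpTo⁺₁ traded (suc T) (λ i<j _ eq → <⇒≢ i<j (traded-injective eq)) ,
    length-applyUpTo traded (suc T) ,
    All.applyUpTo⁺₁ traded (suc T) (λ j<t → IsRep-traded (≤-pred j<t))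
    where
    body : ℕ → List ℕ
    body j = (e₁ + j * A) ∷ es ++ [ q ∸ j * y₁ ]
    traded : ℕ → List ℕ
    traded j = (h ∸ sum (body j)) ∷ body j
    traded-injective : ∀ {i j} → traded i ≡ traded j → i ≡ j
    traded-injective eq = *-cancelʳ-≡ _ _ A (+-cancelˡ-≡ e₁ _ _ (∷-injectiveˡ (∷-injectiveʳ eq)))
    IsRep-traded : ∀ {j} → j ≤ T → IsRep (bracket (y₁ ∷ ys′) A) h n (traded j)
    IsRep-traded {j} j≤T = lengths , m∸n+n≡m sum≤h , value
      where
      jy₁≤q : j * y₁ ≤ q
      jy₁≤q = ≤-trans (*-monoˡ-≤ y₁ j≤T) Ty₁≤q
      c : ℕ
      c = q ∸ j * y₁
      lengths : length (traded j) ≡ length (bracket (y₁ ∷ ys′) A)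
      lengths = cong (λ l → suc (suc l)) (trans (length-++ es) (trans (cong (_+ 1) len) (sym (length-++ ys′))))
      sum≤h : sum (body j) ≤ h
      sum≤h = begin
        e₁ + j * A + sum (es ++ [ c ])  ≡⟨ cong (e₁ + j * A +_) (trans (sum-++ es [ c ]) (cong (sum es +_) (+-identityʳ c))) ⟩
        e₁ + j * A + (sum es + c)       ≡⟨ regroup e₁ (j * A) (sum es) c ⟩
        sum (e₁ ∷ es) + j * A + c       ≤⟨ +-mono-≤ (+-monoʳ-≤ (sum (e₁ ∷ es)) (*-monoˡ-≤ A j≤T)) (m∸n≤m q (j * y₁)) ⟩
        sum (e₁ ∷ es) + T * A + q       ≤⟨ fits ⟩
        h                               ∎
        where
        open ≤-Reasoning
        regroup : ∀ e jA s c → e + jA + (s + c) ≡ e + s + jA + c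
        regroup = solve-∀
      value : traded j · bracket (y₁ ∷ ys′) A ≡ n
      value = begin
        (h ∸ sum (body j)) * 0 + ((e₁ + j * A) * y₁ + (es ++ [ c ]) · (ys′ ++ [ A ]))
          ≡⟨ cong₂ (λ z w → z + ((e₁ + j * A) * y₁ + w)) (*-zeroʳ (h ∸ sum (body j))) (·-snoc es ys′ c A len) ⟩
        (e₁ + j * A) * y₁ + (es · ys′ + c * A)
          ≡⟨ regroup e₁ j A y₁ (es · ys′) c ⟩
        (e₁ ∷ es) · (y₁ ∷ ys′) + (j * y₁ + c) * A
          ≡⟨ cong (λ x → (e₁ ∷ es) · (y₁ ∷ ys′) + x * A) (m+[n∸m]≡n jy₁≤q) ⟩
        (e₁ ∷ es) · (y₁ ∷ ys′) + q * A
          ≡⟨ sym n≡ ⟩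
        n ∎
        where
        open ≡-Reasoning
        regroup : ∀ e₁ j A y₁ w c → (e₁ + j * A) * y₁ + (w + c * A) ≡ e₁ * y₁ + w + (j * y₁ + c) * A
        regroup = solve-∀

  module Modulus (a′ : ℕ) where

    A : ℕ
    A = suc a′

    infix 4 _≡ₘ_

    record _≡ₘ_ (x y : ℕ) : Set where
      constructor mod
      field %-≡ : x % A ≡ y % A

    ≡ₘ-refl : ∀ {x} → x ≡ₘ x
    ≡ₘ-refl = mod refl

    ≡ₘ-trans : ∀ {x y z} → x ≡ₘ y → y ≡ₘ z → x ≡ₘ z
    ≡ₘ-trans (mod p) (mod q) = mod (trans p q)

    ≡ₘ-+ : ∀ {x x′ y y′} → x ≡ₘ x′ → y ≡ₘ y′ → x + y ≡ₘ x′ + y′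
    ≡ₘ-+ {x} {x′} {y} {y′} (mod eq) (mod eq′) = mod (begin
      (x + y) % A             ≡⟨ %-distribˡ-+ x y A ⟩
      (x % A + y % A) % A     ≡⟨ cong₂ (λ p q → (p + q) % A) eq eq′ ⟩
      (x′ % A + y′ % A) % A   ≡⟨ sym (%-distribˡ-+ x′ y′ A) ⟩
      (x′ + y′) % A           ∎)
      where open ≡-Reasoning

    ≡ₘ-* : ∀ {x x′ y y′} → x ≡ₘ x′ → y ≡ₘ y′ → x * y ≡ₘ x′ * y′
    ≡ₘ-* {x} {x′} {y} {y′} (mod eq) (mod eq′) = mod (begin
      (x * y) % A             ≡⟨ %-distribˡ-* x y A ⟩
      (x % A * (y % A)) % A   ≡⟨ cong₂ (λ p q → (p * q) % A) eq eq′ ⟩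
      (x′ % A * (y′ % A)) % A ≡⟨ sym (%-distribˡ-* x′ y′ A) ⟩
      (x′ * y′) % A           ∎)
      where open ≡-Reasoning

    %-≡ₘ : ∀ x → x % A ≡ₘ x
    %-≡ₘ x = mod (m%n%n≡m%n x A)

    +*A-≡ₘ : ∀ x k → x + k * A ≡ₘ x
    +*A-≡ₘ x k = mod ([m+kn]%n≡m%n x k A)

    ≡ₘ⇒+*A : ∀ {s n} → s ≡ₘ n → s ≤ n → Σ ℕ λ q → n ≡ s + q * A
    ≡ₘ⇒+*A {s} {n} (mod eq) s≤n = q , (begin
      n                          ≡⟨ m≡m%n+[m/n]*n n A ⟩
      n % A + n / A * A          ≡⟨ cong₂ (λ r m → r + m * A) (sym eq) (sym (m+[n∸m]≡n (/-monoˡ-≤ A s≤n))) ⟩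
      s % A + (s / A + q) * A    ≡⟨ regroup (s % A) (s / A) q A ⟩
      s % A + s / A * A + q * A  ≡⟨ cong (_+ q * A) (sym (m≡m%n+[m/n]*n s A)) ⟩
      s + q * A                  ∎)
      where
      open ≡-Reasoning
      q : ℕ
      q = n / A ∸ s / A
      regroup : ∀ r p q A → r + (p + q) * A ≡ r + p * A + q * A
      regroup = solve-∀

    Combination : List ℕ → ℕ → Set
    Combination ys w = Σ (List ℕ) λ f → length f ≡ length ys × f · ys ≡ₘ w

    Combination-resp : ∀ {ys w w′} → w ≡ₘ w′ → Combination ys w → Combination ys w′
    Combination-resp w≡w′ (f , len , eq) = f , len , ≡ₘ-trans eq w≡w′

    Combination-∷ : ∀ {ys w} y c r → Combination ys w → Combination (y ∷ ys) (c * y + r * w)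
    Combination-∷ {ys} y c r (f , len , eq) =
      c ∷ map (r *_) f , cong suc (trans (length-map _ f) len) ,
      ≡ₘ-+ ≡ₘ-refl (subst (_≡ₘ r * _) (sym (·-scale r f ys)) (≡ₘ-* (≡ₘ-refl {r}) eq))

    -- Bézout for gcd y w, with the negative coefficient made positive by −v ≡ a′ v (mod A).
    Combination-gcd : ∀ {ys w} y → Combination ys w → Combination (y ∷ ys) (gcd y w)
    Combination-gcd {ys} {w} y comb with Bézout.identity (gcd-GCD y w)
    ... | Bézout.+- x z eq = Combination-resp
            (subst (_≡ₘ gcd y w) (trans (regroup (gcd y w) z w a′) (cong (λ v → v + z * a′ * w) eq)) (+*A-≡ₘ (gcd y w) (z * w)))
            (Combination-∷ y x (z * a′) comb)
      where
      regroup : ∀ d z w a′ → d + z * w * suc a′ ≡ d + z * w + z * a′ * w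
      regroup = solve-∀
    ... | Bézout.-+ x z eq = Combination-resp
            (subst (_≡ₘ gcd y w) (trans (regroup (gcd y w) x y a′) (cong (λ v → v + x * a′ * y) eq)) (+*A-≡ₘ (gcd y w) (x * y)))
            (subst (Combination (y ∷ ys)) (+-comm (x * a′ * y) (z * w)) (Combination-∷ y (x * a′) z comb))
      where
      regroup : ∀ d x y a′ → d + x * y * suc a′ ≡ d + x * y + x * a′ * y
      regroup = solve-∀

    Combination-foldr-gcd : ∀ ys → Combination ys (foldr gcd A ys)
    Combination-foldr-gcd []       = [] , refl , mod (sym (n%n≡0 A))
    Combination-foldr-gcd (y ∷ ys) = Combination-gcd y (Combination-foldr-gcd ys)

    foldr-gcd-∣ : ∀ ys → foldr gcd A ys ∣ A × All (foldr gcd A ys ∣_) ys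
    foldr-gcd-∣ []       = ∣-refl , []
    foldr-gcd-∣ (y ∷ ys) with foldr-gcd-∣ ys
    ... | ∣A , ∣ys = ∣-trans g∣g′ ∣A , gcd[m,n]∣m y _ ∷ All.map (∣-trans g∣g′) ∣ys
      where
      g∣g′ : gcd y (foldr gcd A ys) ∣ foldr gcd A ys
      g∣g′ = gcd[m,n]∣n y (foldr gcd A ys)

    Combination-1 : ∀ {ys} → JointlyCoprime A ys → Combination ys 1
    Combination-1 {ys} coprime =
      subst (Combination ys) (coprime (proj₁ (foldr-gcd-∣ ys)) (proj₂ (foldr-gcd-∣ ys))) (Combination-foldr-gcd ys)

    -- With f · ys ≡ 1, the coefficients n f reduced mod A realise the residue of n.
    residue-coefficients : ∀ {ys} → JointlyCoprime A ys → ∀ n →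
      Σ (List ℕ) λ e → length e ≡ length ys × All (_≤ a′) e × e · ys ≡ₘ n
    residue-coefficients {ys} coprime n with Combination-1 coprime
    ... | f , len , eq =
      e , trans (length-map _ (map (n *_) f)) (trans (length-map _ f) len) ,
      All.map⁺ (All.tabulate (λ {x} _ → ≤-pred (m%n<n x A))) ,
      ≡ₘ-trans (·-% (map (n *_) f) ys)
        (subst₂ _≡ₘ_ (sym (·-scale n f ys)) (*-identityʳ n) (≡ₘ-* (≡ₘ-refl {n}) eq))
      where
      e : List ℕ
      e = map (_% A) (map (n *_) f)
      ·-% : ∀ g xs → map (_% A) g · xs ≡ₘ g · xs
      ·-% []      _        = ≡ₘ-refl
      ·-% (_ ∷ _) []       = ≡ₘ-refl
      ·-% (c ∷ g) (x ∷ xs) = ≡ₘ-+ (≡ₘ-* (%-≡ₘ c) ≡ₘ-refl) (·-% g xs)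

    Reps-large : ∀ {y₁ ys′} T {h n} → All (_≤ a′) (y₁ ∷ ys′) → JointlyCoprime A (y₁ ∷ ys′) →
      length (y₁ ∷ ys′) * a′ * a′ + T * a′ * A ≤ n →
      (length (y₁ ∷ ys′) * a′ + T * A) * A + n ≤ h * A →
      Reps (bracket (y₁ ∷ ys′) A) h n (suc T)
    Reps-large {y₁} {ys′} T {h} {n} ys≤a′ coprime n-large h-large =
      from-coefficients (proj₁ coefficients) (proj₂ coefficients)
      where
      L : ℕ
      L = length (y₁ ∷ ys′)
      coefficients : Σ (List ℕ) λ e → length e ≡ L × All (_≤ a′) e × e · (y₁ ∷ ys′) ≡ₘ n
      coefficients = residue-coefficients coprime n
      from-coefficients : ∀ e → length e ≡ L × All (_≤ a′) e × e · (y₁ ∷ ys′) ≡ₘ n →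
        Reps (bracket (y₁ ∷ ys′) A) h n (suc T)
      from-coefficients (e₁ ∷ es) (len , e≤a′ , e≡n) = Reps-trade A y₁ ys′ e₁ es q T (suc-injective len) Ty₁≤q fits n≡
        where
        s : ℕ
        s = (e₁ ∷ es) · (y₁ ∷ ys′)
        sum≤ : sum (e₁ ∷ es) ≤ L * a′
        sum≤ = subst (λ l → sum (e₁ ∷ es) ≤ l * a′) len (sum-≤ a′ (e₁ ∷ es) e≤a′)
        s≤ : s ≤ L * a′ * a′
        s≤ = ≤-trans (·-≤ a′ (e₁ ∷ es) _ ys≤a′) (*-monoˡ-≤ a′ sum≤)
        quotient : Σ ℕ λ q → n ≡ s + q * A
        quotient = ≡ₘ⇒+*A e≡n (≤-trans s≤ (≤-trans (m≤m+n _ _) n-large))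
        q : ℕ
        q = proj₁ quotient
        n≡ : n ≡ s + q * A
        n≡ = proj₂ quotient
        Ta′≤q : T * a′ ≤ q
        Ta′≤q = *-cancelʳ-≤ _ _ A (+-cancelˡ-≤ s _ _ (begin
          s + T * a′ * A             ≤⟨ +-monoˡ-≤ _ s≤ ⟩
          L * a′ * a′ + T * a′ * A   ≤⟨ n-large ⟩
          n                          ≡⟨ n≡ ⟩
          s + q * A                  ∎))
          where open ≤-Reasoning
        Ty₁≤q : T * y₁ ≤ q
        Ty₁≤q = ≤-trans (*-monoʳ-≤ T (All.head ys≤a′)) Ta′≤q
        fits : sum (e₁ ∷ es) + T * A + q ≤ h
        fits = *-cancelʳ-≤ _ _ A (begin
          (sum (e₁ ∷ es) + T * A + q) * A   ≤⟨ *-monoˡ-≤ A (+-monoˡ-≤ q (+-monoˡ-≤ (T * A) sum≤)) ⟩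
          (L * a′ + T * A + q) * A          ≡⟨ *-distribʳ-+ A (L * a′ + T * A) q ⟩
          (L * a′ + T * A) * A + q * A      ≤⟨ +-monoʳ-≤ _ (≤-trans (m≤n+m (q * A) s) (≤-reflexive (sym n≡))) ⟩
          (L * a′ + T * A) * A + n          ≤⟨ h-large ⟩
          h * A                             ∎)
          where open ≤-Reasoning

  runStart : ∀ {P : ℕ → Set} → Decidable P → ℕ → ℕ
  runStart P? zero    = zero
  runStart P? (suc N) with P? N
  ... | yes _ = runStart P? N
  ... | no  _ = suc N

  runStart-≤ : ∀ {P : ℕ → Set} (P? : Decidable P) N → runStart P? N ≤ N
  runStart-≤ P? zero    = z≤n
  runStart-≤ P? (suc N) with P? N
  ... | yes _ = m≤n⇒m≤1+n (runStart-≤ P? N)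
  ... | no  _ = ≤-refl

  runStart-holds : ∀ {P : ℕ → Set} (P? : Decidable P) N {m} → runStart P? N ≤ m → m < N → P m
  runStart-holds P? (suc N) {m} start≤m m<N with P? N
  ... | no  _  = ⊥-elim (<⇒≱ m<N start≤m)
  ... | yes pN with m ≟ N
  ...   | yes refl = pN
  ...   | no  m≢N  = runStart-holds P? N start≤m (≤∧≢⇒< (≤-pred m<N) m≢N)

  runStart-fails : ∀ {P : ℕ → Set} (P? : Decidable P) N {p} → runStart P? N ≡ suc p → ¬ P p
  runStart-fails P? (suc N) eq with P? N
  ... | yes _  = runStart-fails P? N eq
  ... | no ¬pN with refl ← eq = ¬pN

  halves : ∀ H m → m ≤ H → 2 * m ≤ H ⊎ 2 * (H ∸ m) ≤ H
  halves H m m≤H with 2 * m ≤? H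
  ... | yes 2m≤H = inj₁ 2m≤H
  ... | no  2m≰H = inj₂ (+-cancelˡ-≤ (2 * m) _ _ (begin
    2 * m + 2 * (H ∸ m)  ≡⟨ sym (*-distribˡ-+ 2 m (H ∸ m)) ⟩
    2 * (m + (H ∸ m))    ≡⟨ cong (2 *_) (m+[n∸m]≡n m≤H) ⟩
    H + (H + 0)          ≡⟨ cong (H +_) (+-identityʳ H) ⟩
    H + H                ≤⟨ +-monoˡ-≤ H (≰⇒≥ 2m≰H) ⟩
    2 * m + H            ∎))
    where open ≤-Reasoning

  +-≤-halves : ∀ {x y H} → 2 * x ≤ H → 2 * y ≤ H → x + y ≤ H
  +-≤-halves {x} {y} {H} 2x≤H 2y≤H = *-cancelˡ-≤ 2 (begin
    2 * (x + y)      ≡⟨ *-distribˡ-+ 2 x y ⟩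
    2 * x + 2 * y    ≤⟨ +-mono-≤ 2x≤H 2y≤H ⟩
    H + H            ≡⟨ cong (H +_) (sym (+-identityʳ H)) ⟩
    2 * H            ∎)
    where open ≤-Reasoning

  Shape : ℕ → ℕ → List ℕ → List ℕ → ℕ → ℕ → Set
  Shape c d C D H m = m ∈ C ⊎ (c ≤ m × m + d ≤ H) ⊎ Σ ℕ λ p → p ∈ D × m + p ≡ H

  module Structure (a′ T L′ : ℕ) where

    open Modulus a′ using (A; Reps-large)

    -- Reps-large covers n ≥ N₀ once K A + n ≤ h A; hₜ is the paper's (k − 1)(t a_k − 1) a_k + 1,
    -- with L = k − 1 and a′ + T A = t A − 1.
    L t N₀ K hₜ : ℕ
    L  = suc L′
    t  = suc T
    N₀ = L * a′ * a′ + T * a′ * A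
    K  = L * a′ + T * A
    hₜ = L * (a′ + T * A) * A + 1

    N₀≤hₜ : N₀ ≤ hₜ
    N₀≤hₜ = begin
      L * a′ * a′ + T * a′ * A        ≤⟨ +-mono-≤ (*-monoʳ-≤ (L * a′) (n≤1+n a′))
                                                  (*-monoˡ-≤ A (≤-trans (*-monoʳ-≤ T (n≤1+n a′)) (m≤n*m (T * A) L))) ⟩
      L * a′ * A + L * (T * A) * A    ≡⟨ regroup L a′ T A ⟩
      L * (a′ + T * A) * A            ≤⟨ m≤m+n _ 1 ⟩
      hₜ                              ∎
      where
      open ≤-Reasoning
      regroup : ∀ L a′ T A → L * a′ * A + L * (T * A) * A ≡ L * (a′ + T * A) * A
      regroup = solve-∀

    2K≤hₜ : 1 ≤ a′ → 2 * K ≤ hₜ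
    2K≤hₜ 1≤a′ = begin
      2 * K                           ≡⟨ *-comm 2 K ⟩
      (L * a′ + T * A) * 2            ≤⟨ *-mono-≤ (+-monoʳ-≤ (L * a′) (m≤n*m (T * A) L)) (s≤s 1≤a′) ⟩
      (L * a′ + L * (T * A)) * A      ≡⟨ cong (_* A) (sym (*-distribˡ-+ L a′ (T * A))) ⟩
      L * (a′ + T * A) * A            ≤⟨ m≤m+n _ 1 ⟩
      hₜ                              ∎
      where open ≤-Reasoning

    Bounded : List ℕ → Set
    Bounded ys = All (λ y → 1 ≤ y × y ≤ a′) ys

    module Side (ys : List ℕ) (len : length ys ≡ L) (bounded : Bounded ys) (coprime : JointlyCoprime A ys) where

      xs : List ℕ
      xs = bracket ys A

      xs≤A : All (_≤ A) xs
      xs≤A = z≤n ∷ All.++⁺ (All.map (λ (_ , y≤a′) → m≤n⇒m≤1+n y≤a′) bounded) (≤-refl ∷ [])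

      positive : All (1 ≤_) (ys ++ [ A ])
      positive = All.++⁺ (All.map proj₁ bounded) (s≤s z≤n ∷ [])

      1≤a′ : 1 ≤ a′
      1≤a′ = head-bound ys len bounded
        where
        head-bound : ∀ zs → length zs ≡ L → Bounded zs → 1 ≤ a′
        head-bound (_ ∷ _) _ ((1≤z , z≤a′) ∷ _) = ≤-trans 1≤z z≤a′

      -- r_{A,h}(m) is the same for all h ≥ m; Stable m says that this stable value is at least t.
      Stable : ℕ → Set
      Stable m = t ≤ count xs m m

      stable? : Decidable Stable
      stable? m = t ≤? count xs m m

      c : ℕ
      c = runStart stable? N₀

      C : List ℕ
      C = filter stable? (upTo c)

      Reps⇒Stable : ∀ {h m} → Reps xs h m t → Stable m
      Reps⇒Stable reps = Reps⇒≤count xs _ _ t (Reps-resize (ys ++ [ A ]) positive ≤-refl reps)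

      Stable⇒Reps : ∀ {h m} → m ≤ h → Stable m → Reps xs h m t
      Stable⇒Reps m≤h stable = Reps-resize (ys ++ [ A ]) positive m≤h (≤count⇒Reps xs _ _ t stable)

      Reps⇒≤hA : ∀ {h m} → Reps xs h m t → m ≤ h * A
      Reps⇒≤hA (u ∷ _ , _ , _ , (_ , refl , refl) ∷ _) = ·-≤ A u xs xs≤A

      c≤hₜ : c ≤ hₜ
      c≤hₜ = ≤-trans (runStart-≤ stable? N₀) N₀≤hₜ

      C-bound : All (λ x → x + 2 ≤ c) C
      C-bound = All.tabulate bound
        where
        bound : ∀ {m} → m ∈ C → m + 2 ≤ c
        bound {m} m∈C with ∈-filter⁻ stable? {xs = upTo c} m∈C
        ... | m∈ , stable with suc m ≟ c
        ...   | yes 1+m≡c = ⊥-elim (runStart-fails stable? N₀ (sym 1+m≡c) stable)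
        ...   | no  1+m≢c = subst (_≤ c) (+-comm 2 m) (≤∧≢⇒< (∈-upTo⁻ m∈) 1+m≢c)

      ∈C⇒< : ∀ {m} → m ∈ C → m < c
      ∈C⇒< m∈C = ∈-upTo⁻ (proj₁ (∈-filter⁻ stable? {xs = upTo c} m∈C))

      Reps⇒∈C : ∀ {h m} → m < c → Reps xs h m t → m ∈ C
      Reps⇒∈C m<c reps = ∈-filter⁺ stable? (∈-upTo⁺ m<c) (Reps⇒Stable reps)

      ∈C⇒Reps : ∀ {h m} → hₜ ≤ h → m ∈ C → Reps xs h m t
      ∈C⇒Reps hₜ≤h m∈C =
        Stable⇒Reps (≤-trans (<⇒≤ (∈C⇒< m∈C)) (≤-trans c≤hₜ hₜ≤h)) (proj₂ (∈-filter⁻ stable? {xs = upTo c} m∈C))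

      Reps-lower-half : ∀ {h m} → hₜ ≤ h → c ≤ m → 2 * m ≤ h * A → Reps xs h m t
      Reps-lower-half {h} {m} hₜ≤h c≤m 2m≤hA with m <? N₀
      ... | yes m<N₀ = Stable⇒Reps (≤-trans (<⇒≤ m<N₀) (≤-trans N₀≤hₜ hₜ≤h)) (runStart-holds stable? N₀ c≤m m<N₀)
      ... | no  m≮N₀ = beyond ys len bounded coprime
        where
        KA+m≤hA : K * A + m ≤ h * A
        KA+m≤hA = +-≤-halves {K * A} {m} (subst (_≤ h * A) (*-assoc 2 K A) (*-monoˡ-≤ A (≤-trans (2K≤hₜ 1≤a′) hₜ≤h))) 2m≤hA
        beyond : ∀ zs → length zs ≡ L → Bounded zs → JointlyCoprime A zs → Reps (bracket zs A) h m t
        beyond (z ∷ zs) len bounded coprime =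
          Reps-large T (All.map proj₂ bounded) coprime
            (subst (λ l → l * a′ * a′ + T * a′ * A ≤ m) (sym len) (≮⇒≥ m≮N₀))
            (subst (λ l → (l * a′ + T * A) * A + m ≤ h * A) (sym len) KA+m≤hA)

    module Dual (ys : List ℕ) (len : length ys ≡ L) (bounded : Bounded ys) (coprime : JointlyCoprime A ys) where

      ys≤A : All (_≤ A) ys
      ys≤A = All.map (λ (_ , y≤a′) → m≤n⇒m≤1+n y≤a′) bounded

      reflect-bounds : ∀ {y} → 1 ≤ y × y ≤ a′ → 1 ≤ A ∸ y × A ∸ y ≤ a′
      reflect-bounds {suc y} (_ , y<a′) = m<n⇒0<n∸m y<a′ , m∸n≤m a′ y

      module S₁ = Side ys len bounded coprime
      module S₂ = Side (reflect A ys) (trans (length-reflect A ys) len)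
                       (All-reflect A ys (All.map reflect-bounds bounded)) (JointlyCoprime-reflect A ys ys≤A coprime)

      Reps-dual : ∀ {h m} → Reps S₁.xs h m t → Reps S₂.xs h (h * A ∸ m) t
      Reps-dual = subst (λ xs → Reps xs _ _ t) (reflect-bracket A ys) ∘ Reps-reflect A S₁.xs S₁.xs≤A

      Reps-via-dual : ∀ {h m} → m ≤ h * A → Reps S₂.xs h (h * A ∸ m) t → Reps S₁.xs h m t
      Reps-via-dual {h} {m} m≤hA =
        subst₂ (λ xs n → Reps xs h n t) reflect-twice (m∸[m∸n]≡n m≤hA) ∘ Reps-reflect A S₂.xs S₂.xs≤A
        where
        reflect-twice : reflect A S₂.xs ≡ S₁.xs
        reflect-twice = trans (reflect-bracket A (reflect A ys)) (cong (λ zs → bracket zs A) (reflect-involutive A ys ys≤A))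

      Reps⇒Shape : ∀ {h m} → Reps S₁.xs h m t → Shape S₁.c S₂.c S₁.C S₂.C (h * A) m
      Reps⇒Shape {h} {m} reps = classify (m <? S₁.c) (h * A ∸ m <? S₂.c)
        where
        m≤hA : m ≤ h * A
        m≤hA = S₁.Reps⇒≤hA reps
        classify : Dec (m < S₁.c) → Dec (h * A ∸ m < S₂.c) → Shape S₁.c S₂.c S₁.C S₂.C (h * A) m
        classify (yes m<c) _         = inj₁ (S₁.Reps⇒∈C m<c reps)
        classify (no _)    (yes p<d) = inj₂ (inj₂ (h * A ∸ m , S₂.Reps⇒∈C p<d (Reps-dual reps) , m+[n∸m]≡n m≤hA))
        classify (no m≮c)  (no p≮d)  =
          inj₂ (inj₁ (≮⇒≥ m≮c , ≤-trans (+-monoʳ-≤ m (≮⇒≥ p≮d)) (≤-reflexive (m+[n∸m]≡n m≤hA))))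

      Shape⇒Reps : ∀ {h m} → hₜ ≤ h → Shape S₁.c S₂.c S₁.C S₂.C (h * A) m → Reps S₁.xs h m t
      Shape⇒Reps hₜ≤h (inj₁ m∈C) = S₁.∈C⇒Reps hₜ≤h m∈C
      Shape⇒Reps {h} {m} hₜ≤h (inj₂ (inj₂ (p , p∈D , m+p≡hA))) =
        Reps-via-dual (subst (m ≤_) m+p≡hA (m≤m+n m p))
          (subst (λ n → Reps S₂.xs h n t) (sym (trans (cong (_∸ m) (sym m+p≡hA)) (m+n∸m≡n m p))) (S₂.∈C⇒Reps hₜ≤h p∈D))
      Shape⇒Reps {h} {m} hₜ≤h (inj₂ (inj₁ (c≤m , m+d≤hA))) with halves (h * A) m (≤-trans (m≤m+n m S₂.c) m+d≤hA)
      ... | inj₁ 2m≤hA = S₁.Reps-lower-half hₜ≤h c≤m 2m≤hA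
      ... | inj₂ 2p≤hA = Reps-via-dual (≤-trans (m≤m+n m S₂.c) m+d≤hA)
                           (S₂.Reps-lower-half hₜ≤h (m+n≤o⇒m≤o∸n S₂.c (subst (_≤ h * A) (+-comm m S₂.c) m+d≤hA)) 2p≤hA)

    EventualShape : List ℕ → Set
    EventualShape ys =
      Σ ℕ λ c → Σ ℕ λ d → Σ (List ℕ) λ C → Σ (List ℕ) λ D →
      All (λ x → x + 2 ≤ c) C × All (λ x → x + 2 ≤ d) D × d ≤ hₜ ×
      (∀ h → hₜ ≤ h → ∀ m → Reps (bracket ys A) h m t ⇔ Shape c d C D (h * A) m)

    eventualShape : ∀ ys → length ys ≡ L → Bounded ys → JointlyCoprime A ys → EventualShape ys
    eventualShape ys len bounded coprime =
      S₁.c , S₂.c , S₁.C , S₂.C , S₁.C-bound , S₂.C-bound , S₂.c≤hₜ ,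
      λ h hₜ≤h m → mk⇔ Reps⇒Shape (Shape⇒Reps hₜ≤h)
      where open Dual ys len bounded coprime

module Integers where

  open import Defs
  open Naturals
  open import Data.Nat as ℕ using (ℕ; zero; suc; _∸_; _≤_; _<_; z≤n; s≤s)
  open import Data.Nat.Properties
    using (suc-pred; <⇒≤pred; ≤-trans; +-comm; m≤n+m; m≤m+n; m≤m*n; m+n≤o⇒m≤o∸n; m≤o∸n⇒m+n≤o; m+n∸n≡m; m∸n+n≡m)
  open import Data.Nat.GCD using (gcd; gcd-greatest)
  open import Data.Nat.Divisibility using (_∣_; _∣0; ∣1⇒≡1)
  open import Data.Integer as ℤ using (ℤ; +_; -[1+_]; ∣_∣; _-_)
  import Data.Integer.Properties as ℤ
  import Data.Integer.GCD as ℤ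
  open import Data.Fin as Fin using (Fin; fromℕ; inject₁; toℕ)
  open import Data.Fin.Properties using (toℕ-fromℕ; inject₁ℕ<)
  open import Data.List using (List; []; _∷_; [_]; map; foldr; tabulate; length; _++_; filter)
  open import Data.List.Properties using (length-++; tabulate-cong; map-tabulate; length-tabulate; filter-≐; filter-none)
  open import Data.List.Relation.Unary.All as All using (All; []; _∷_)
  import Data.List.Relation.Unary.All.Properties as All
  open import Data.List.Relation.Unary.Any using (Any)
  import Data.List.Relation.Unary.Any.Properties as Any
  open import Data.List.Membership.Propositional using (_∈_; find; lose)
  open import Data.List.Membership.Propositional.Properties using (∈-map⁺; ∈-map⁻)
  open import Relation.Nullary using (¬_)
  open import Data.Empty using (⊥-elim)
  import Function.Properties.Equivalence as ⇔
  open import Data.Product using (Σ; _×_; _,_)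
  open import Data.Sum using (_⊎_; inj₁; inj₂)
  open import Function.Bundles using (_⇔_; mk⇔)
  open import Function using (_∘_)
  open import Relation.Binary.PropositionalEquality hiding ([_])

  tabulate-inject₁ : ∀ {B : Set} n (f : Fin (suc n) → B) → tabulate f ≡ tabulate (f ∘ inject₁) ++ [ f (fromℕ n) ]
  tabulate-inject₁ zero    f = refl
  tabulate-inject₁ (suc n) f = cong (f Fin.zero ∷_) (tabulate-inject₁ n (f ∘ Fin.suc))

  foldr-gcd-+ : ∀ xs → foldr ℤ.gcd (+ 0) (map +_ xs) ≡ + foldr gcd 0 xs
  foldr-gcd-+ []       = refl
  foldr-gcd-+ (x ∷ xs) = cong (ℤ.gcd (+ x)) (foldr-gcd-+ xs)

  ∣-foldr-gcd : ∀ {d xs} → All (d ∣_) xs → d ∣ foldr gcd 0 xs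
  ∣-foldr-gcd {d} []           = d ∣0
  ∣-foldr-gcd     (d∣x ∷ d∣xs) = gcd-greatest d∣x (∣-foldr-gcd d∣xs)

  module NaturalForm {k : ℕ} (a : Fin (suc (suc k)) → ℤ) (a₀≡0 : a Fin.zero ≡ + 0)
                     (increasing : ∀ i j → i Fin.< j → a i ℤ.< a j) where

    ∣a∣ : Fin (suc (suc k)) → ℕ
    ∣a∣ i = ∣ a i ∣

    +∣a∣ : ∀ i → + ∣a∣ i ≡ a i
    +∣a∣ Fin.zero    = trans (cong (+_ ∘ ∣_∣) a₀≡0) (sym a₀≡0)
    +∣a∣ (Fin.suc i) =
      ℤ.0≤i⇒+∣i∣≡i (subst (ℤ._≤ a (Fin.suc i)) a₀≡0 (ℤ.<⇒≤ (increasing Fin.zero (Fin.suc i) (s≤s z≤n))))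

    ∣a∣-increasing : ∀ i j → i Fin.< j → ∣a∣ i < ∣a∣ j
    ∣a∣-increasing i j i<j = ℤ.drop‿+<+ (subst₂ ℤ._<_ (sym (+∣a∣ i)) (sym (+∣a∣ j)) (increasing i j i<j))

    ∣a∣-positive : ∀ i → 0 < ∣a∣ (Fin.suc i)
    ∣a∣-positive i = subst (_< ∣a∣ (Fin.suc i)) (cong ∣_∣ a₀≡0) (∣a∣-increasing Fin.zero (Fin.suc i) (s≤s z≤n))

    inner : Fin k → Fin (suc (suc k))
    inner i = Fin.suc (inject₁ i)

    inner<last : ∀ i → inner i Fin.< fromℕ (suc k)
    inner<last i = s≤s (subst (toℕ (inject₁ i) <_) (sym (toℕ-fromℕ k)) (inject₁ℕ< i))

    a′ : ℕ
    a′ = ℕ.pred (∣a∣ (fromℕ (suc k)))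

    A : ℕ
    A = suc a′

    A≡∣aₖ∣ : A ≡ ∣a∣ (fromℕ (suc k))
    A≡∣aₖ∣ = suc-pred _ {{ℕ.>-nonZero (∣a∣-positive (fromℕ k))}}

    ys : List ℕ
    ys = tabulate (∣a∣ ∘ inner)

    length-ys : length ys ≡ k
    length-ys = length-tabulate (∣a∣ ∘ inner)

    ys-bounded : All (λ y → 1 ≤ y × y ≤ a′) ys
    ys-bounded = All.tabulate⁺ λ i →
      ∣a∣-positive (inject₁ i) ,
      <⇒≤pred (∣a∣-increasing (inner i) (fromℕ (suc k)) (inner<last i))

    aₖ≡A : a (fromℕ (suc k)) ≡ + A
    aₖ≡A = trans (sym (+∣a∣ (fromℕ (suc k)))) (cong +_ (sym A≡∣aₖ∣))

    elems≡bracket : elems a ≡ map +_ (bracket ys A)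
    elems≡bracket = begin
      tabulate a                  ≡⟨ tabulate-cong (sym ∘ +∣a∣) ⟩
      tabulate (+_ ∘ ∣a∣)         ≡⟨ sym (map-tabulate ∣a∣ +_) ⟩
      map +_ (tabulate ∣a∣)       ≡⟨ cong (λ zs → map +_ (∣a∣ Fin.zero ∷ zs)) (tabulate-inject₁ k (∣a∣ ∘ Fin.suc)) ⟩
      map +_ (∣a∣ Fin.zero ∷ ys ++ [ ∣a∣ (fromℕ (suc k)) ])
        ≡⟨ cong₂ (λ z w → map +_ (z ∷ ys ++ [ w ])) (cong ∣_∣ a₀≡0) (sym A≡∣aₖ∣) ⟩
      map +_ (bracket ys A)       ∎
      where open ≡-Reasoning

    ys-coprime : gcdSet a ≡ + 1 → JointlyCoprime A ys
    ys-coprime gcd≡1 {d} d∣A d∣ys = ∣1⇒≡1 (subst (d ∣_) gcd≡1′ (∣-foldr-gcd (d ∣0 ∷ All.++⁺ d∣ys (d∣A ∷ []))))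
      where
      gcd≡1′ : foldr gcd 0 (bracket ys A) ≡ 1
      gcd≡1′ = ℤ.+-injective (begin
        + foldr gcd 0 (bracket ys A)               ≡⟨ foldr-gcd-+ (bracket ys A) ⟨
        foldr ℤ.gcd (+ 0) (map +_ (bracket ys A))  ≡⟨ cong (foldr ℤ.gcd (+ 0)) elems≡bracket ⟨
        gcdSet a                                   ≡⟨ gcd≡1 ⟩
        + 1                                        ∎)
        where open ≡-Reasoning

  +-∸ : ∀ {m n} → n ≤ m → + m - + n ≡ + (m ∸ n)
  +-∸ {m} {n} n≤m = trans (ℤ.m-n≡m⊖n m n) (ℤ.⊖-≥ n≤m)

  weight-+ : ∀ u xs → weight u (map +_ xs) ≡ + (u · xs)
  weight-+ []      _        = refl
  weight-+ (_ ∷ _) []       = refl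
  weight-+ (c ∷ u) (x ∷ xs) = trans (cong₂ ℤ._+_ (sym (ℤ.pos-* c x)) (weight-+ u xs)) (sym (ℤ.pos-+ (c ℕ.* x) (u · xs)))

  rep≡count : ∀ {k} (a : Fin (suc k) → ℤ) xs h m → elems a ≡ map +_ xs → length xs ≡ suc k →
    rep a h (+ m) ≡ count xs h m
  rep≡count {k} a xs h m elems≡ len = begin
    length (filter (λ u → weight u (elems a) ℤ.≟ + m) (families (suc k) h))
      ≡⟨ cong (λ e → length (filter (λ u → weight u e ℤ.≟ + m) (families (suc k) h))) elems≡ ⟩
    length (filter (λ u → weight u (map +_ xs) ℤ.≟ + m) (families (suc k) h))
      ≡⟨ cong length (filter-≐ _ _ ((λ {u} → weight⇒· {u}) , (λ {u} → ·⇒weight {u})) (families (suc k) h)) ⟩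
    length (filter (λ u → u · xs ℕ.≟ m) (families (suc k) h))
      ≡⟨ cong (λ l → length (filter (λ u → u · xs ℕ.≟ m) (families l h))) len ⟨
    count xs h m ∎
    where
    open ≡-Reasoning
    weight⇒· : ∀ {u} → weight u (map +_ xs) ≡ + m → u · xs ≡ m
    weight⇒· {u} eq = ℤ.+-injective (trans (sym (weight-+ u xs)) eq)
    ·⇒weight : ∀ {u} → u · xs ≡ m → weight u (map +_ xs) ≡ + m
    ·⇒weight {u} eq = trans (weight-+ u xs) (cong +_ eq)

  rep-negative : ∀ {k} (a : Fin (suc k) → ℤ) xs h m → elems a ≡ map +_ xs → rep a h -[1+ m ] ≡ 0
  rep-negative {k} a xs h m elems≡ = cong length (filter-none _ (All.universal never (families (suc k) h)))
    where
    never : ∀ u → ¬ weight u (elems a) ≡ -[1+ m ]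
    never u eq with () ← trans (sym (weight-+ u xs)) (subst (λ e → weight u e ≡ -[1+ m ]) elems≡ eq)

  ZShape : ℕ → ℕ → List ℤ → List ℤ → ℤ → ℤ → Set
  ZShape c d C D H n = n ∈ C ⊎ (+ c ℤ.≤ n × n ℤ.≤ H - + d) ⊎ Any (λ x → n ≡ H - x) D

  -- The conclusion of theorem2 with a (fromℕ k) abstracted, so that it can be rewritten to + A.
  Conclusion : (k : ℕ) → (Fin (suc k) → ℤ) → ℕ → ℤ → Set
  Conclusion k a t aₖ =
    Σ ℕ λ c → Σ ℕ λ d → Σ (List ℤ) λ C → Σ (List ℤ) λ D →
    All (λ x → + 0 ℤ.≤ x × x ℤ.≤ + c - + 2) C × All (λ x → + 0 ℤ.≤ x × x ℤ.≤ + d - + 2) D ×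
    (∀ h → (+ k - + 1) ℤ.* (+ t ℤ.* aₖ - + 1) ℤ.* aₖ ℤ.+ + 1 ℤ.≤ + h →
      ∀ n → hAt a h t n ⇔ ZShape c d C D (+ h ℤ.* aₖ) n)

  bounds-ℤ : ∀ {c} C → All (λ x → x ℕ.+ 2 ≤ c) C → All (λ x → + 0 ℤ.≤ x × x ℤ.≤ + c - + 2) (map +_ C)
  bounds-ℤ C bounded = All.map⁺ (All.map (λ {x} x+2≤c →
    ℤ.+≤+ z≤n , subst (+ x ℤ.≤_) (sym (+-∸ (≤-trans (m≤n+m 2 x) x+2≤c))) (ℤ.+≤+ (m+n≤o⇒m≤o∸n x x+2≤c))) bounded)

  ∈-bounded : ∀ {d H D p} → All (λ x → x ℕ.+ 2 ≤ d) D → d ≤ H → p ∈ D → p ≤ H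
  ∈-bounded D-bound d≤H p∈D = ≤-trans (≤-trans (m≤m+n _ 2) (All.lookup D-bound p∈D)) d≤H

  Shape⇔ZShape : ∀ {c d C D H} m → d ≤ H → All (λ x → x ℕ.+ 2 ≤ d) D →
    Shape c d C D H m ⇔ ZShape c d (map +_ C) (map +_ D) (+ H) (+ m)
  Shape⇔ZShape {c} {d} {C} {D} {H} m d≤H D-bound = mk⇔ to from
    where
    p≤H : ∀ {p} → p ∈ D → p ≤ H
    p≤H = ∈-bounded D-bound d≤H
    to : Shape c d C D H m → ZShape c d (map +_ C) (map +_ D) (+ H) (+ m)
    to (inj₁ m∈C)                    = inj₁ (∈-map⁺ +_ m∈C)
    to (inj₂ (inj₁ (c≤m , m+d≤H)))   =
      inj₂ (inj₁ (ℤ.+≤+ c≤m , subst (+ m ℤ.≤_) (sym (+-∸ d≤H)) (ℤ.+≤+ (m+n≤o⇒m≤o∸n m m+d≤H))))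
    to (inj₂ (inj₂ (p , p∈D , m+p≡H))) = inj₂ (inj₂ (Any.map⁺ (lose p∈D (begin
      + m              ≡⟨ cong +_ (trans (sym (m+n∸n≡m m p)) (cong (_∸ p) m+p≡H)) ⟩
      + (H ∸ p)        ≡⟨ +-∸ (p≤H p∈D) ⟨
      + H - + p        ∎))))
      where open ≡-Reasoning
    from : ZShape c d (map +_ C) (map +_ D) (+ H) (+ m) → Shape c d C D H m
    from (inj₁ m∈C) with ∈-map⁻ +_ m∈C
    ... | x , x∈C , refl = inj₁ x∈C
    from (inj₂ (inj₁ (ℤ.+≤+ c≤m , m≤H-d))) =
      inj₂ (inj₁ (c≤m , m≤o∸n⇒m+n≤o m d≤H (ℤ.drop‿+≤+ (subst (+ m ℤ.≤_) (+-∸ d≤H) m≤H-d))))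
    from (inj₂ (inj₂ m≡H-D)) with find (Any.map⁻ m≡H-D)
    ... | p , p∈D , m≡H-p = inj₂ (inj₂ (p , p∈D ,
      trans (cong (ℕ._+ p) (ℤ.+-injective (trans m≡H-p (+-∸ (p≤H p∈D))))) (m∸n+n≡m (p≤H p∈D))))

  ¬ZShape-negative : ∀ {c d C D H} m → d ≤ H → All (λ x → x ℕ.+ 2 ≤ d) D →
    ¬ ZShape c d (map +_ C) (map +_ D) (+ H) -[1+ m ]
  ¬ZShape-negative m d≤H D-bound (inj₁ m∈C) with ∈-map⁻ +_ m∈C
  ... | _ , _ , ()
  ¬ZShape-negative m d≤H D-bound (inj₂ (inj₁ (() , _)))
  ¬ZShape-negative m d≤H D-bound (inj₂ (inj₂ m≡H-D)) with find (Any.map⁻ m≡H-D)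
  ... | p , p∈D , m≡H-p with () ← trans m≡H-p (+-∸ (∈-bounded D-bound d≤H p∈D))

  hAt⇔Reps : ∀ {k} (a : Fin (suc k) → ℤ) xs {h t m} → elems a ≡ map +_ xs → length xs ≡ suc k →
    hAt a h t (+ m) ⇔ Reps xs h m t
  hAt⇔Reps a xs {h} {t} {m} elems≡ len = mk⇔
    (λ t≤rep → ≤count⇒Reps xs h m t (subst (t ≤_) (rep≡count a xs h m elems≡ len) t≤rep))
    (λ reps → subst (t ≤_) (sym (rep≡count a xs h m elems≡ len)) (Reps⇒≤count xs h m t reps))

  ¬hAt-negative : ∀ {k} (a : Fin (suc k) → ℤ) xs {h t m} → 1 ≤ t → elems a ≡ map +_ xs → ¬ hAt a h t -[1+ m ]
  ¬hAt-negative a xs {h} {m = m} (s≤s _) elems≡ t≤rep with () ← subst (_ ≤_) (rep-negative a xs h m elems≡) t≤rep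

  hₜ-ℤ : ∀ a′ T L′ →
    (+ suc (suc L′) - + 1) ℤ.* (+ suc T ℤ.* + suc a′ - + 1) ℤ.* + suc a′ ℤ.+ + 1 ≡ + Structure.hₜ a′ T L′
  hₜ-ℤ a′ T L′ =
    trans (cong (λ z → z ℤ.* + suc a′ ℤ.+ + 1) (sym (ℤ.pos-* (suc L′) (a′ ℕ.+ T ℕ.* suc a′))))
          (trans (cong (ℤ._+ + 1) (sym (ℤ.pos-* (suc L′ ℕ.* (a′ ℕ.+ T ℕ.* suc a′)) (suc a′)))) (sym (ℤ.pos-+ _ 1)))

  transfer : ∀ {a′ T L′} (a : Fin (suc (suc (suc L′))) → ℤ) ys → length ys ≡ suc L′ →
    elems a ≡ map +_ (bracket ys (suc a′)) → Structure.EventualShape a′ T L′ ys →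
    Conclusion (suc (suc L′)) a (suc T) (+ suc a′)
  transfer {a′} {T} {L′} a ys len elems≡ (c , d , C , D , C-bound , D-bound , d≤hₜ , shape) =
    c , d , map +_ C , map +_ D , bounds-ℤ C C-bound , bounds-ℤ D D-bound , describes
    where
    length-bracket : length (bracket ys (suc a′)) ≡ suc (suc (suc L′))
    length-bracket = cong suc (trans (length-++ ys) (trans (+-comm (length ys) 1) (cong suc len)))
    describes : ∀ h → (+ suc (suc L′) - + 1) ℤ.* (+ suc T ℤ.* + suc a′ - + 1) ℤ.* + suc a′ ℤ.+ + 1 ℤ.≤ + h →
      ∀ n → hAt a h (suc T) n ⇔ ZShape c d (map +_ C) (map +_ D) (+ h ℤ.* + suc a′) n
    describes h hₜ≤h n =
      subst (λ H → hAt a h (suc T) n ⇔ ZShape c d (map +_ C) (map +_ D) H n) (ℤ.pos-* h (suc a′)) (at n)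
      where
      hₜ≤h′ : Structure.hₜ a′ T L′ ≤ h
      hₜ≤h′ = ℤ.drop‿+≤+ (subst (ℤ._≤ + h) (hₜ-ℤ a′ T L′) hₜ≤h)
      d≤hA : d ≤ h ℕ.* suc a′
      d≤hA = ≤-trans d≤hₜ (≤-trans hₜ≤h′ (m≤m*n h (suc a′)))
      at : ∀ n → hAt a h (suc T) n ⇔ ZShape c d (map +_ C) (map +_ D) (+ (h ℕ.* suc a′)) n
      at (+ m)     =
        ⇔.trans (hAt⇔Reps a _ elems≡ length-bracket) (⇔.trans (shape h hₜ≤h′ m) (Shape⇔ZShape m d≤hA D-bound))
      at -[1+ m ] = mk⇔ (⊥-elim ∘ ¬hAt-negative a _ (s≤s z≤n) elems≡) (⊥-elim ∘ ¬ZShape-negative m d≤hA D-bound)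

open import Defs
open import Data.Nat as ℕ using (ℕ; zero; suc)
open import Data.Integer as ℤ using (ℤ; +_; _-_; _*_; _+_)
open import Data.Fin as Fin using (Fin; fromℕ)
open import Data.List using (List)
open import Data.List.Relation.Unary.All using (All)
open import Data.List.Relation.Unary.Any using (Any)
open import Data.List.Membership.Propositional using (_∈_)
open import Data.Product using (Σ; _×_)
open import Data.Sum using (_⊎_)
open import Function.Bundles using (_⇔_)
open import Relation.Binary.PropositionalEquality using (_≡_; sym; subst)
open Naturals using (module Structure)
open Integers using (module NaturalForm; Conclusion; transfer)

theorem2 : (k : ℕ) → 2 ℕ.≤ k →
  (a : Fin (suc k) → ℤ) → a Fin.zero ≡ + 0 →
  (∀ (i j : Fin (suc k)) → i Fin.< j → a i ℤ.< a j) →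
  gcdSet a ≡ + 1 →
  (t : ℕ) → 1 ℕ.≤ t →
  Σ ℕ λ c → Σ ℕ λ d → Σ (List ℤ) λ C → Σ (List ℤ) λ D →
    All (λ x → + 0 ℤ.≤ x × x ℤ.≤ + c - + 2) C ×
    All (λ x → + 0 ℤ.≤ x × x ℤ.≤ + d - + 2) D ×
    (∀ (h : ℕ) →
      (+ k - + 1) * (+ t * a (fromℕ k) - + 1) * a (fromℕ k) + + 1 ℤ.≤ + h →
      ∀ (n : ℤ) →
        hAt a h t n ⇔
          (n ∈ C
            ⊎ (+ c ℤ.≤ n × n ℤ.≤ + h * a (fromℕ k) - + d)
            ⊎ Any (λ x → n ≡ + h * a (fromℕ k) - x) D))
theorem2 (suc (suc L′)) (ℕ.s≤s (ℕ.s≤s _)) a a₀≡0 increasing gcd≡1 (suc T) (ℕ.s≤s _) =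
  subst (Conclusion (suc (suc L′)) a (suc T)) (sym aₖ≡A)
    (transfer a ys length-ys elems≡bracket (eventualShape ys length-ys ys-bounded (ys-coprime gcd≡1)))
  where
  open NaturalForm a a₀≡0 increasing
  open Structure a′ T L′ using (eventualShape)
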